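{- Let $2<k<n$. The $k$-uniform flower $\mathcal{V}_n$ is a hypertree if and only if $2k-1\leq n\leq 4(k-1)$. It is an edge-minimal hypertree if and only if $3(k-1)\leq n\leq 4(k-1)$.
   Context: Hypergraphs are finite, $k$-uniform and have no multiple edges. A chain is a nonempty $k$-uniform hypergraph admitting a sequence $v_1,\dots,v_l$ of its vertices, in which every vertex appears at least once, with $v_1\ne v_l$, such that the sets $\{v_i,\dots,v_{i+k-1}\}$ ($1\le i\le l-k+1$) are pairwise distinct and are exactly its edges; a semicycle is defined the same way but with $v_1=v_l$. A hypergraph is chain-connected if every pair of its vertices lies in some subhypergraph that is a chain, and semicycle-free if it has no subhypergraph that is a semicycle. A hypertree is a chain-connected semicycle-free $k$-uniform hypergraph; it is an edge-minimal hypertree if deleting any one of its edges (keeping the vertex set) yields a hypergraph that is not a hypertree. For $n>k$, the $k$-uniform flower $\mathcal{V}_n$ has vertex set $\{v_1,\dots,v_{n-1},u_1\}$ and edge set $\{\{v_i,v_{i+1},\dots,v_{i+k-2},u_1\}: 1\le i\le n-1\}$, where indices of the $v$'s are understood cyclically modulo $n-1$. -}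

module Defs where

open import Data.Nat using (ℕ; zero; suc; _+_; _*_; _∸_; _≤_; _<_; _≡ᵇ_)
open import Data.Nat.DivMod using (_%_)
open import Data.Bool using (Bool; _∨_; true; false)
open import Data.Fin using (Fin; toℕ)
open import Data.Fin.Subset using (Subset; ⁅_⁆; _∪_; ⊥)
open import Data.Vec using (tabulate)
open import Data.List using (List; []; _∷_; length; take; drop; map; upTo; head; last)
open import Data.Bool.ListAction using (any)
open import Data.List.Relation.Unary.All using (All)
open import Data.List.Relation.Unary.Unique.Propositional using (Unique)
open import Data.List.Membership.Propositional using (_∈_)
open import Data.Product using (Σ; _×_; ∃)
open import Relation.Nullary using (¬_)
open import Data.Unit using (⊤)
open import Relation.Binary.PropositionalEquality using (_≡_; _≢_)

-- A hypergraph on the ambient vertex type Fin N: a vertex set and a set of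
-- edges, each edge being a subset of Fin N (so there are no multiple edges).
record Hypergraph (N : ℕ) : Set₁ where
  field
    Vert : Fin N → Set
    Edge : Subset N → Set
open Hypergraph public

toSet : {N : ℕ} → List (Fin N) → Subset N
toSet []       = ⊥
toSet (x ∷ xs) = ⁅ x ⁆ ∪ toSet xs

-- the windows {v_i,...,v_{i+k-1}}, 1 ≤ i ≤ l-k+1 (0-based here)
windows : {N : ℕ} → ℕ → List (Fin N) → List (Subset N)
windows k s = map (λ i → toSet (take k (drop i s))) (upTo (suc (length s ∸ k)))

-- The subhypergraph it
-- determines has vertex set {v_1..v_l} and edge set the windows.
record WindowSeq {N : ℕ} (k : ℕ) (H : Hypergraph N) (s : List (Fin N)) : Set where
  field
    nonempty  : k ≤ length s
    verts     : All (Vert H) s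
    edges     : All (Edge H) (windows k s)
    distinct  : Unique (windows k s)

IsChainIn : {N : ℕ} → ℕ → Hypergraph N → List (Fin N) → Set
IsChainIn k H s = WindowSeq k H s × head s ≢ last s

IsSemicycleIn : {N : ℕ} → ℕ → Hypergraph N → List (Fin N) → Set
IsSemicycleIn k H s = WindowSeq k H s × head s ≡ last s

ChainConnected : {N : ℕ} → ℕ → Hypergraph N → Set
ChainConnected k H = ∀ x y → Vert H x → Vert H y → x ≢ y →
  ∃ λ s → IsChainIn k H s × x ∈ s × y ∈ s

SemicycleFree : {N : ℕ} → ℕ → Hypergraph N → Set
SemicycleFree k H = ∀ s → ¬ IsSemicycleIn k H s

IsHypertree : {N : ℕ} → ℕ → Hypergraph N → Set
IsHypertree k H = ChainConnected k H × SemicycleFree k H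

deleteEdge : {N : ℕ} → Hypergraph N → Subset N → Hypergraph N
deleteEdge H e = record { Vert = Vert H ; Edge = λ f → Edge H f × f ≢ e }

IsEdgeMinimalHypertree : {N : ℕ} → ℕ → Hypergraph N → Set
IsEdgeMinimalHypertree k H =
  IsHypertree k H × (∀ e → Edge H e → ¬ IsHypertree k (deleteEdge H e))

-- reduction modulo m (only used with m = n-1 ≥ 1)
cyc : ℕ → ℕ → ℕ
cyc zero    x = x
cyc (suc m) x = x % suc m

-- Flower V_n on vertex set Fin n: vertex v_{j+1} is j (0 ≤ j < n-1), u_1 is n-1.
-- Edge number i+1 (0 ≤ i < n-1) is {v_{i+1},...,v_{i+k-1}} ∪ {u_1}, indices cyclic
-- modulo n-1.
flowerEdge : (k n i : ℕ) → Subset n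
flowerEdge k n i = tabulate λ x →
  (toℕ x ≡ᵇ (n ∸ 1)) ∨ any (λ t → toℕ x ≡ᵇ cyc (n ∸ 1) (i + t)) (upTo (k ∸ 1))

flower : (k n : ℕ) → Hypergraph n
flower k n = record
  { Vert = λ _ → ⊤
  ; Edge = λ e → Σ ℕ λ i → (i < n ∸ 1) × (e ≡ flowerEdge k n i) }

-- Write ℓ = k − 1 and m = n − 1: the petal vertices form a cycle of length m, and every edge is u₁
-- together with an arc of ℓ consecutive petal vertices.  In a window sequence inside any part of the
-- flower with 2ℓ ≤ m, consecutive windows are distinct petals sharing all but one vertex, hence
-- neighbouring arcs, and distinctness keeps them moving in one direction: the windows are the
-- petals c, c + 1, …, c + w with w ≤ ℓ, and the sequence only visits v_c, …, v_{c+w+ℓ−1}.  The vertex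
-- dropped by the first (or last) window cannot come back, so there is no semicycle; if m ≥ 4ℓ then
-- v₀ and v_{2ℓ} lie on no common chain; and once petal i is deleted (3ℓ ≤ m + 1) neither do v_i and
-- v_{i+ℓ−1}.  Conversely v_c … v_{c+ℓ−1} u₁ v_{c+ℓ} … v_{c+2ℓ−1} is a chain, and for m < 4ℓ every two
-- vertices lie on one of these; for m < 2ℓ the same construction closes up into a semicycle, and for
-- m + 1 < 3ℓ the chains avoiding the last petal still connect everything.

module Submission where

open import Defs
open import Data.Bool using (Bool; T; _∨_)
open import Data.Bool.ListAction using (any)
open import Data.Bool.Properties using (T-∨; T-≡)
open import Data.Empty using (⊥; ⊥-elim)
open import Data.Fin as Fin using (Fin; toℕ; fromℕ; fromℕ<)
open import Data.Fin.Properties as Fin using (toℕ-fromℕ; toℕ-fromℕ<; toℕ-injective; toℕ<n; pigeonhole)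
open import Data.Fin.Subset using (Subset; _∈_; _∉_; _⊆_; ⁅_⁆)
open import Data.Fin.Subset.Properties using (⊆-antisym; x∈p∪q⁺; x∈p∪q⁻; x∈⁅x⁆; x∈⁅y⁆⇒x≡y; ∉⊥)
open import Data.List using (List; []; _∷_; length; take; drop; map; upTo; applyUpTo; head; last)
open import Data.List.Membership.Propositional using (find; lose) renaming (_∈_ to _∈ₗ_)
open import Data.List.Membership.Propositional.Properties using (∈-upTo⁺; ∈-upTo⁻; ∈-applyUpTo⁺)
open import Data.List.Properties using (map-upTo; length-applyUpTo)
open import Data.List.Relation.Unary.All as All using (All)
open import Data.List.Relation.Unary.All.Properties using (map⁻; applyUpTo⁺₁)
open import Data.List.Relation.Unary.AllPairs using (_∷_)
open import Data.List.Relation.Unary.Any using (here; there)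
open import Data.List.Relation.Unary.Any.Properties using (any⁺; any⁻)
open import Data.List.Relation.Unary.Unique.Propositional using (Unique)
import Data.List.Relation.Unary.Unique.Propositional.Properties as Unique
open import Data.Maybe using (just)
open import Data.Maybe.Properties using (just-injective)
open import Data.Nat
open import Data.Nat.DivMod
open import Data.Nat.Properties
open import Data.Nat.Tactic.RingSolver using (solve-∀)
open import Data.Product using (∃₂; ∃-syntax; _×_; _,_; proj₁; proj₂)
open import Data.Product.Function.NonDependent.Propositional using (_×-⇔_)
open import Data.Sum as Sum using (_⊎_; inj₁; inj₂)
open import Data.Unit using (⊤; tt)
open import Data.Vec using (tabulate)
open import Data.Vec.Properties using (lookup∘tabulate; []=⇒lookup; lookup⇒[]=)
open import Function.Base using (_$_)
open import Function.Bundles using (Equivalence; _⇔_; mk⇔)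
import Function.Properties.Equivalence as ⇔
open import Relation.Binary.Definitions using (tri<; tri≈; tri>)
open import Relation.Binary.PropositionalEquality
open import Relation.Nullary using (¬_; yes; no)
open import Relation.Nullary.Decidable using (decidable-stable)

[m%d+n]%d≡[m+n]%d : ∀ m n d .{{_ : NonZero d}} → (m % d + n) % d ≡ (m + n) % d
[m%d+n]%d≡[m+n]%d m n d = begin
  (m % d + n) % d          ≡⟨ %-distribˡ-+ (m % d) n d ⟩
  (m % d % d + n % d) % d  ≡⟨ cong (λ x → (x + n % d) % d) (m%n%n≡m%n m d) ⟩
  (m % d + n % d) % d      ≡⟨ %-distribˡ-+ m n d ⟨
  (m + n) % d              ∎
  where open ≡-Reasoning

[m+n]%d≢m : ∀ {m n d} .{{_ : NonZero d}} → m < d → 0 < n → n < d → (m + n) % d ≢ m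
[m+n]%d≢m {m} {n} {d} m<d 0<n n<d eq with m + n <? d
... | yes m+n<d = <⇒≢ (m<m+n m 0<n) (sym (trans (sym (m<n⇒m%n≡m m+n<d)) eq))
... | no m+n≮d = <⇒≢ n<d (+-cancelˡ-≡ m n d (begin
  m + n          ≡⟨ m∸n+n≡m d≤m+n ⟨
  m + n ∸ d + d  ≡⟨ cong (_+ d) wrapped ⟩
  m + d          ∎))
  where
  open ≡-Reasoning
  d≤m+n : d ≤ m + n
  d≤m+n = ≮⇒≥ m+n≮d
  m+n∸d<d : m + n ∸ d < d
  m+n∸d<d = +-cancelʳ-< _ _ d (subst (_< d + d) (sym (m∸n+n≡m d≤m+n)) (+-mono-< m<d n<d))
  wrapped : m + n ∸ d ≡ m
  wrapped = trans (sym (m<n⇒m%n≡m m+n∸d<d)) (trans (m≤n⇒[n∸m]%m≡n%m d≤m+n) eq)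

[c+b]%d≡[[c+a]%d+[b∸a]]%d : ∀ c {a b} d .{{_ : NonZero d}} → a ≤ b → (c + b) % d ≡ ((c + a) % d + (b ∸ a)) % d
[c+b]%d≡[[c+a]%d+[b∸a]]%d c {a} {b} d a≤b = sym (begin
  ((c + a) % d + (b ∸ a)) % d  ≡⟨ [m%d+n]%d≡[m+n]%d (c + a) (b ∸ a) d ⟩
  (c + a + (b ∸ a)) % d        ≡⟨ cong (_% d) (+-assoc c a (b ∸ a)) ⟩
  (c + (a + (b ∸ a))) % d      ≡⟨ cong (λ x → (c + x) % d) (m+[n∸m]≡n a≤b) ⟩
  (c + b) % d                  ∎)
  where open ≡-Reasoning

[z+a]%d≢[z+b]%d : ∀ z {a b d} .{{_ : NonZero d}} → a < b → b < d → (z + a) % d ≢ (z + b) % d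
[z+a]%d≢[z+b]%d z {a} {b} {d} a<b b<d eq =
  [m+n]%d≢m (m%n<n (z + a) d) (m<n⇒0<n∸m a<b) (≤-<-trans (m∸n≤m b a) b<d)
    (trans (sym ([c+b]%d≡[[c+a]%d+[b∸a]]%d z d (<⇒≤ a<b))) (sym eq))

+-cancelˡ-% : ∀ z {a b d} .{{_ : NonZero d}} → a < d → b < d → (z + a) % d ≡ (z + b) % d → a ≡ b
+-cancelˡ-% z {a} {b} a<d b<d eq with <-cmp a b
... | tri< a<b _ _ = ⊥-elim ([z+a]%d≢[z+b]%d z a<b b<d eq)
... | tri≈ _ a≡b _ = a≡b
... | tri> _ _ b<a = ⊥-elim ([z+a]%d≢[z+b]%d z b<a a<d (sym eq))

%-offset : ∀ c {x d} .{{_ : NonZero d}} → x < d → ∃[ δ ] δ < d × x ≡ (c + δ) % d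
%-offset c {x} {d} x<d with c % d ≤? x
... | yes c%d≤x = x ∸ c % d , ≤-<-trans (m∸n≤m x (c % d)) x<d , sym (begin
  (c + (x ∸ c % d)) % d         ≡⟨ [m%d+n]%d≡[m+n]%d c (x ∸ c % d) d ⟨
  (c % d + (x ∸ c % d)) % d     ≡⟨ cong (_% d) (m+[n∸m]≡n c%d≤x) ⟩
  x % d                         ≡⟨ m<n⇒m%n≡m x<d ⟩
  x                             ∎)
  where open ≡-Reasoning
... | no c%d≰x = x + d ∸ c % d , δ<d , sym (begin
  (c + (x + d ∸ c % d)) % d      ≡⟨ [m%d+n]%d≡[m+n]%d c (x + d ∸ c % d) d ⟨
  (c % d + (x + d ∸ c % d)) % d  ≡⟨ cong (_% d) (m+[n∸m]≡n c%d≤x+d) ⟩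
  (x + d) % d                    ≡⟨ [m+n]%n≡m%n x d ⟩
  x % d                          ≡⟨ m<n⇒m%n≡m x<d ⟩
  x                              ∎)
  where
  open ≡-Reasoning
  c%d≤x+d : c % d ≤ x + d
  c%d≤x+d = ≤-trans (m%n≤n c d) (m≤n+m d x)
  δ<d : x + d ∸ c % d < d
  δ<d = +-cancelʳ-< (c % d) _ d
    (subst₂ _<_ (sym (m∸n+n≡m c%d≤x+d)) (+-comm (c % d) d) (+-monoˡ-< d (≰⇒> c%d≰x)))

Unique-applyUpTo⁻ : ∀ {A : Set} (f : ℕ → A) n → Unique (applyUpTo f n) → ∀ {i j} → i < j → j < n → f i ≢ f j
Unique-applyUpTo⁻ f (suc n) (fresh ∷ _) {zero} {suc j} _ (s≤s j<n) = All.lookup fresh (∈-applyUpTo⁺ (λ x → f (suc x)) j<n)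
Unique-applyUpTo⁻ f (suc n) (_ ∷ unique) {suc i} {suc j} (s≤s i<j) (s≤s j<n) =
  Unique-applyUpTo⁻ (λ x → f (suc x)) n unique i<j j<n

module _ {A : Set} (default : A) where

  at : List A → ℕ → A
  at []       _       = default
  at (x ∷ _)  zero    = x
  at (_ ∷ xs) (suc p) = at xs p

  ∈⇒at : ∀ xs {x} → x ∈ₗ xs → ∃[ p ] p < length xs × at xs p ≡ x
  ∈⇒at (x ∷ xs) (here refl) = 0 , z<s , refl
  ∈⇒at (x ∷ xs) (there x∈)  with p , p< , eq ← ∈⇒at xs x∈ = suc p , s≤s p< , eq

  ∈-take⁻ : ∀ k xs {x} → x ∈ₗ take k xs → ∃[ p ] p < k × p < length xs × at xs p ≡ x
  ∈-take⁻ (suc k) (x ∷ xs) (here refl) = 0 , z<s , z<s , refl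
  ∈-take⁻ (suc k) (x ∷ xs) (there x∈) with p , p<k , p< , eq ← ∈-take⁻ k xs x∈ =
    suc p , s≤s p<k , s≤s p< , eq

  ∈-take⁺ : ∀ k xs {p} → p < k → p < length xs → at xs p ∈ₗ take k xs
  ∈-take⁺ (suc k) (x ∷ xs) {zero}  _          _          = here refl
  ∈-take⁺ (suc k) (x ∷ xs) {suc p} (s≤s p<k) (s≤s p<) = there (∈-take⁺ k xs p<k p<)

  ∈-window⁻ : ∀ k j xs {x} → x ∈ₗ take k (drop j xs) → ∃[ p ] p < k × j + p < length xs × at xs (j + p) ≡ x
  ∈-window⁻ k       zero    xs       x∈ = ∈-take⁻ k xs x∈
  ∈-window⁻ (suc k) (suc j) []       ()
  ∈-window⁻ k       (suc j) (_ ∷ xs) x∈ with p , p<k , j+p< , eq ← ∈-window⁻ k j xs x∈ =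
    p , p<k , s≤s j+p< , eq

  ∈-window⁺ : ∀ k j xs {p} → p < k → j + p < length xs → at xs (j + p) ∈ₗ take k (drop j xs)
  ∈-window⁺ k zero    xs       p<k p<         = ∈-take⁺ k xs p<k p<
  ∈-window⁺ k (suc j) (_ ∷ xs) p<k (s≤s j+p<) = ∈-window⁺ k j xs p<k j+p<

  at-applyUpTo : ∀ (f : ℕ → A) L {p} → p < L → at (applyUpTo f L) p ≡ f p
  at-applyUpTo f (suc L) {zero}  _         = refl
  at-applyUpTo f (suc L) {suc p} (s≤s p<) = at-applyUpTo (λ i → f (suc i)) L p<

  last≡at : ∀ x xs → last (x ∷ xs) ≡ just (at (x ∷ xs) (length xs))
  last≡at x []       = refl
  last≡at x (y ∷ xs) = last≡at y xs

  head≡last⇒at≡at : ∀ xs → 0 < length xs → head xs ≡ last xs → at xs 0 ≡ at xs (length xs ∸ 1)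
  head≡last⇒at≡at (x ∷ xs) _ eq = just-injective (trans eq (last≡at x xs))

∈-tabulate⁻ : ∀ {N} (f : Fin N → Bool) {x} → x ∈ tabulate f → T (f x)
∈-tabulate⁻ f {x} x∈ = Equivalence.from T-≡ (trans (sym (lookup∘tabulate f x)) ([]=⇒lookup x∈))

∈-tabulate⁺ : ∀ {N} (f : Fin N → Bool) {x} → T (f x) → x ∈ tabulate f
∈-tabulate⁺ f {x} fx = lookup⇒[]= x (tabulate f) (trans (lookup∘tabulate f x) (Equivalence.to T-≡ fx))

∈-toSet⁻ : ∀ {N} (xs : List (Fin N)) {z} → z ∈ toSet xs → z ∈ₗ xs
∈-toSet⁻ []       z∈ = ⊥-elim (∉⊥ z∈)
∈-toSet⁻ (x ∷ xs) z∈ with x∈p∪q⁻ ⁅ x ⁆ (toSet xs) z∈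
... | inj₁ z∈⁅x⁆ = here (x∈⁅y⁆⇒x≡y x z∈⁅x⁆)
... | inj₂ z∈xs  = there (∈-toSet⁻ xs z∈xs)

∈-toSet⁺ : ∀ {N} (xs : List (Fin N)) {z} → z ∈ₗ xs → z ∈ toSet xs
∈-toSet⁺ (x ∷ xs) (here refl) = x∈p∪q⁺ (inj₁ (x∈⁅x⁆ x))
∈-toSet⁺ (x ∷ xs) (there z∈)  = x∈p∪q⁺ (inj₂ (∈-toSet⁺ xs z∈))

module Flower (ℓ₀ m₀ : ℕ) (ℓ<m : suc (suc ℓ₀) < suc m₀) where

  -- u is u₁ (the vertex m), v x is the petal vertex x mod m, and petal i is u together with
  -- the arc v i, …, v (i + ℓ − 1)

  ℓ k m n : ℕ
  ℓ = suc (suc ℓ₀)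
  k = suc ℓ
  m = suc m₀
  n = suc m

  petal : ℕ → Subset n
  petal = flowerEdge k n

  inPetal : ℕ → Fin n → Bool
  inPetal i x = (toℕ x ≡ᵇ m) ∨ any (λ t → toℕ x ≡ᵇ (i + t) % m) (upTo ℓ)

  OnArc : ℕ → ℕ → Set
  OnArc i x = ∃[ t ] t < ℓ × x ≡ (i + t) % m

  ∈-petal⁻ : ∀ i {z} → z ∈ petal i → toℕ z ≡ m ⊎ OnArc i (toℕ z)
  ∈-petal⁻ i {z} z∈ with Equivalence.to T-∨ (∈-tabulate⁻ (inPetal i) z∈)
  ... | inj₁ z≡m = inj₁ (≡ᵇ⇒≡ _ _ z≡m)
  ... | inj₂ onArc with t , t∈ , z≡ ← find (any⁻ (λ t → toℕ z ≡ᵇ (i + t) % m) (upTo ℓ) onArc) = inj₂ (t , ∈-upTo⁻ t∈ , ≡ᵇ⇒≡ _ _ z≡)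

  ∈-petal⁺ : ∀ i {z} → toℕ z ≡ m ⊎ OnArc i (toℕ z) → z ∈ petal i
  ∈-petal⁺ i (inj₁ z≡m) = ∈-tabulate⁺ (inPetal i) (Equivalence.from T-∨ (inj₁ (≡⇒≡ᵇ _ _ z≡m)))
  ∈-petal⁺ i {z} (inj₂ (t , t<ℓ , z≡)) =
    ∈-tabulate⁺ (inPetal i) (Equivalence.from (T-∨ {toℕ z ≡ᵇ m}) (inj₂ (any⁺ (λ t → toℕ z ≡ᵇ (i + t) % m) (lose (∈-upTo⁺ t<ℓ) (≡⇒≡ᵇ _ _ z≡)))))

  u : Fin n
  u = fromℕ m

  v : ℕ → Fin n
  v x = fromℕ< (m<n⇒m<1+n (m%n<n x m))

  toℕ-u : toℕ u ≡ m
  toℕ-u = toℕ-fromℕ m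

  toℕ-v : ∀ x → toℕ (v x) ≡ x % m
  toℕ-v x = toℕ-fromℕ< (m<n⇒m<1+n (m%n<n x m))

  v≢u : ∀ x → v x ≢ u
  v≢u x v≡u = <⇒≢ (m%n<n x m) (trans (sym (toℕ-v x)) (trans (cong toℕ v≡u) toℕ-u))

  v≡v⇒%≡% : ∀ x y → v x ≡ v y → x % m ≡ y % m
  v≡v⇒%≡% x y eq = trans (sym (toℕ-v x)) (trans (cong toℕ eq) (toℕ-v y))

  %≡%⇒v≡v : ∀ x y → x % m ≡ y % m → v x ≡ v y
  %≡%⇒v≡v x y eq = toℕ-injective (trans (toℕ-v x) (trans eq (sym (toℕ-v y))))

  v-% : ∀ x → v (x % m) ≡ v x
  v-% x = %≡%⇒v≡v (x % m) x (m%n%n≡m%n x m)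

  v-shift : ∀ a d e → v ((a + d) % m + e) ≡ v (a + (d + e))
  v-shift a d e = %≡%⇒v≡v ((a + d) % m + e) (a + (d + e)) (trans ([m%d+n]%d≡[m+n]%d (a + d) e m) (cong (_% m) (+-assoc a d e)))

  v-cancel : ∀ z {a b} → a < m → b < m → v (z + a) ≡ v (z + b) → a ≡ b
  v-cancel z {a} {b} a<m b<m eq = +-cancelˡ-% z a<m b<m (v≡v⇒%≡% (z + a) (z + b) eq)

  vertex-cases : ∀ (z : Fin n) → z ≡ u ⊎ ∃[ x ] x < m × z ≡ v x
  vertex-cases z with toℕ z <? m
  ... | yes z<m = inj₂ (toℕ z , z<m , toℕ-injective (trans (sym (m<n⇒m%n≡m z<m)) (sym (toℕ-v (toℕ z)))))
  ... | no z≮m  = inj₁ (toℕ-injective (trans (≤-antisym (s≤s⁻¹ (toℕ<n z)) (≮⇒≥ z≮m)) (sym toℕ-u)))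

  u∈petal : ∀ i → u ∈ petal i
  u∈petal i = ∈-petal⁺ i (inj₁ toℕ-u)

  v∈petal⁺ : ∀ i {d} → d < ℓ → v (i + d) ∈ petal i
  v∈petal⁺ i {d} d<ℓ = ∈-petal⁺ i (inj₂ (d , d<ℓ , toℕ-v (i + d)))

  v∈petal⁻ : ∀ i {d} → d < m → v (i + d) ∈ petal i → d < ℓ
  v∈petal⁻ i {d} d<m v∈ with ∈-petal⁻ i v∈
  ... | inj₁ v≡m = ⊥-elim (v≢u (i + d) (toℕ-injective (trans v≡m (sym toℕ-u))))
  ... | inj₂ (t , t<ℓ , v≡) =
    subst (_< ℓ) (+-cancelˡ-% i (<-trans t<ℓ ℓ<m) d<m (sym (trans (sym (toℕ-v (i + d))) v≡))) t<ℓ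

  petal-% : ∀ i → petal (i % m) ≡ petal i
  petal-% i = ⊆-antisym (λ z∈ → ∈-petal⁺ i (shift (i % m) i (λ t → [m%d+n]%d≡[m+n]%d i t m) (∈-petal⁻ (i % m) z∈)))
                        (λ z∈ → ∈-petal⁺ (i % m) (shift i (i % m) (λ t → sym ([m%d+n]%d≡[m+n]%d i t m)) (∈-petal⁻ i z∈)))
    where
    shift : ∀ a b {x} → (∀ t → (a + t) % m ≡ (b + t) % m) → x ≡ m ⊎ OnArc a x → x ≡ m ⊎ OnArc b x
    shift _ _ eq (inj₁ x≡m) = inj₁ x≡m
    shift _ _ eq (inj₂ (t , t<ℓ , x≡)) = inj₂ (t , t<ℓ , trans x≡ (eq t))

  v∉petal : ∀ b {δ} → δ < m → ℓ ≤ δ → v (b + δ) ∉ petal b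
  v∉petal b δ<m ℓ≤δ v∈ = <⇒≱ (v∈petal⁻ b δ<m v∈) ℓ≤δ

  v-rebase : ∀ a {b d d'} e → b ≡ (a + d) % m → d + d' ≡ m → v (a + e) ≡ v (b + (d' + e))
  v-rebase a {d = d} {d'} e refl d+d'≡m = sym (begin
    v ((a + d) % m + (d' + e))  ≡⟨ v-shift a d (d' + e) ⟩
    v (a + (d + (d' + e)))      ≡⟨ cong v (regroup a d d' e) ⟩
    v (a + e + (d + d'))        ≡⟨ cong (λ x → v (a + e + x)) d+d'≡m ⟩
    v (a + e + m)               ≡⟨ %≡%⇒v≡v (a + e + m) (a + e) ([m+n]%n≡m%n (a + e) m) ⟩
    v (a + e)                   ∎)
    where
    open ≡-Reasoning
    regroup : ∀ a d d' e → a + (d + (d' + e)) ≡ a + e + (d + d')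
    regroup = solve-∀

  petal⊆petal⇒≡ : ∀ {a b} → a < m → b < m → petal a ⊆ petal b → a ≡ b
  petal⊆petal⇒≡ {a} {b} a<m b<m a⊆b with a ≟ b
  ... | yes a≡b = a≡b
  ... | no a≢b with %-offset b a<m
  ...   | d , d<m , a≡b+d with ℓ ≤? d
  ...     | yes ℓ≤d = ⊥-elim (v∉petal b d<m ℓ≤d (subst (_∈ petal b) va≡ (a⊆b (v∈petal⁺ a z<s))))
    where
    va≡ : v (a + 0) ≡ v (b + d)
    va≡ = trans (cong v (trans (+-identityʳ a) a≡b+d)) (v-% (b + d))
  ...     | no ℓ≰d = ⊥-elim (<-irrefl refl (v∈petal⁻ b ℓ<m (a⊆b (subst (_∈ petal a) vbℓ≡ (v∈petal⁺ a ℓ∸d<ℓ)))))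
    where
    d<ℓ : d < ℓ
    d<ℓ = ≰⇒> ℓ≰d
    d≢0 : d ≢ 0
    d≢0 refl = a≢b (trans a≡b+d (trans (cong (_% m) (+-identityʳ b)) (m<n⇒m%n≡m b<m)))
    ℓ∸d<ℓ : ℓ ∸ d < ℓ
    ℓ∸d<ℓ = ∸-monoʳ-< (n≢0⇒n>0 d≢0) (<⇒≤ d<ℓ)
    vbℓ≡ : v (a + (ℓ ∸ d)) ≡ v (b + ℓ)
    vbℓ≡ = begin
      v (a + (ℓ ∸ d))               ≡⟨ cong (λ x → v (x + (ℓ ∸ d))) a≡b+d ⟩
      v ((b + d) % m + (ℓ ∸ d))     ≡⟨ v-shift b d (ℓ ∸ d) ⟩
      v (b + (d + (ℓ ∸ d)))         ≡⟨ cong (λ x → v (b + x)) (m+[n∸m]≡n (<⇒≤ d<ℓ)) ⟩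
      v (b + ℓ)                     ∎
      where open ≡-Reasoning

  petal-injective : ∀ {a b} → a < m → b < m → petal a ≡ petal b → a ≡ b
  petal-injective a<m b<m eq = petal⊆petal⇒≡ a<m b<m (λ {z} z∈ → subst (z ∈_) eq z∈)

  Next : ℕ → ℕ → Set
  Next a b = b ≡ (a + 1) % m

  -- If b = a + d with 2 ≤ d ≤ m − 2, two consecutive vertices of petal a lie outside petal b:
  -- near its start if d' = m − d ≥ ℓ, near its end otherwise (then d > ℓ, as 2ℓ ≤ m).
  petal⊆petal∪⁅p⁆⇒Next : ℓ + ℓ ≤ m → ∀ {a b} (p : Fin n) → a < m → b < m → a ≢ b →
                          (∀ {z} → z ∈ petal a → z ∈ petal b ⊎ z ≡ p) → Next a b ⊎ Next b a
  petal⊆petal∪⁅p⁆⇒Next ℓ+ℓ≤m {a} {b} p a<m b<m a≢b a⊆b∪p with d , d<m , b≡a+d ← %-offset a b<m =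
    by-offset d (m ∸ d) d<m b≡a+d (m+[n∸m]≡n (<⇒≤ d<m))
    where
    two-outside : ∀ {d d'} → b ≡ (a + d) % m → d + d' ≡ m → ∀ e → suc e < ℓ → ℓ ≤ d' + e → suc e < d → ⊥
    two-outside {d} {d'} b≡a+d d+d'≡m e 1+e<ℓ ℓ≤d'+e 1+e<d =
      <-irrefl refl (subst (e <_) (sym e≡1+e) (n<1+n e))
      where
      forced : ∀ e → e < ℓ → ℓ ≤ d' + e → e < d → v (a + e) ≡ p
      forced e e<ℓ ℓ≤d'+e e<d with a⊆b∪p (v∈petal⁺ a e<ℓ)
      ... | inj₂ ≡p = ≡p
      ... | inj₁ ∈b = ⊥-elim (v∉petal b d'+e<m ℓ≤d'+e (subst (_∈ petal b) (v-rebase a e b≡a+d d+d'≡m) ∈b))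
        where
        d'+e<m : d' + e < m
        d'+e<m = subst (d' + e <_) (trans (+-comm d' d) d+d'≡m) (+-monoʳ-< d' e<d)
      e≡1+e : e ≡ suc e
      e≡1+e = v-cancel a (<-trans (<-trans (n<1+n e) 1+e<ℓ) ℓ<m) (<-trans 1+e<ℓ ℓ<m)
        (trans (forced e (<-trans (n<1+n e) 1+e<ℓ) ℓ≤d'+e (<-trans (n<1+n e) 1+e<d))
               (sym (forced (suc e) 1+e<ℓ (≤-trans ℓ≤d'+e (+-monoʳ-≤ d' (n≤1+n e))) 1+e<d)))
    by-offset : ∀ d d' → d < m → b ≡ (a + d) % m → d + d' ≡ m → Next a b ⊎ Next b a
    by-offset 0 _ _ b≡a+0 _ = ⊥-elim (a≢b (sym (trans b≡a+0 (trans (cong (_% m) (+-identityʳ a)) (m<n⇒m%n≡m a<m)))))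
    by-offset 1 _ _ b≡a+1 _ = inj₁ b≡a+1
    by-offset (suc (suc d)) 0 d<m _ d+0≡m = ⊥-elim (<-irrefl (trans (sym (+-identityʳ _)) d+0≡m) d<m)
    by-offset (suc (suc d)) 1 _ refl d+1≡m = inj₂ (sym (begin
      ((a + suc (suc d)) % m + 1) % m  ≡⟨ [m%d+n]%d≡[m+n]%d (a + suc (suc d)) 1 m ⟩
      (a + suc (suc d) + 1) % m        ≡⟨ cong (_% m) (+-assoc a (suc (suc d)) 1) ⟩
      (a + (suc (suc d) + 1)) % m      ≡⟨ cong (λ x → (a + x) % m) d+1≡m ⟩
      (a + m) % m                      ≡⟨ [m+n]%n≡m%n a m ⟩
      a % m                            ≡⟨ m<n⇒m%n≡m a<m ⟩
      a                                ∎))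
      where open ≡-Reasoning
    by-offset (suc (suc d)) (suc (suc d')) _ b≡a+d d+d'≡m with ℓ ≤? suc (suc d')
    ... | yes ℓ≤d' = ⊥-elim $ two-outside b≡a+d d+d'≡m 0 (s≤s (s≤s z≤n)) (subst (ℓ ≤_) (sym (+-identityʳ _)) ℓ≤d') (s≤s (s≤s z≤n))
    ... | no ℓ≰d' = ⊥-elim $ two-outside b≡a+d d+d'≡m ℓ₀ ≤-refl (s≤s (s≤s (m≤n+m ℓ₀ d'))) (<⇒≤ ℓ<d)
      where
      ℓ<d : ℓ < suc (suc d)
      ℓ<d = +-cancelʳ-< (suc (suc d')) ℓ (suc (suc d))
        (<-≤-trans (+-monoʳ-< ℓ (≰⇒> ℓ≰d')) (≤-trans ℓ+ℓ≤m (≤-reflexive (sym d+d'≡m))))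

  petal∖next⇒≡v : ∀ a {x} → x ∈ petal a → x ∉ petal (a + 1) → x ≡ v a
  petal∖next⇒≡v a {x} x∈a x∉a+1 with ∈-petal⁻ a x∈a
  ... | inj₁ x≡m = ⊥-elim (x∉a+1 (∈-petal⁺ (a + 1) (inj₁ x≡m)))
  ... | inj₂ (zero , _ , x≡) = toℕ-injective (trans x≡ (trans (cong (_% m) (+-identityʳ a)) (sym (toℕ-v a))))
  ... | inj₂ (suc t , 1+t<ℓ , x≡) =
    ⊥-elim (x∉a+1 (∈-petal⁺ (a + 1) (inj₂ (t , <-trans (n<1+n t) 1+t<ℓ , trans x≡ (cong (_% m) (sym (+-assoc a 1 t)))))))

  Next-injectiveˡ : ∀ {a a' b} → a < m → a' < m → Next a b → Next a' b → a ≡ a'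
  Next-injectiveˡ {a} {a'} a<m a'<m b≡a+1 b≡a'+1 = +-cancelˡ-% 1 a<m a'<m
    (trans (cong (_% m) (+-comm 1 a)) (trans (sym b≡a+1) (trans b≡a'+1 (cong (_% m) (+-comm a' 1)))))

  v∉petal-ahead : ℓ + ℓ ≤ m → ∀ c {q} → 0 < q → q ≤ ℓ → v c ∉ petal (c + q)
  v∉petal-ahead ℓ+ℓ≤m c {q} 0<q q≤ℓ v∈ =
    v∉petal ((c + q) % m) m∸q<m ℓ≤m∸q (subst (_∈ petal ((c + q) % m)) vc≡ (subst (v c ∈_) (sym (petal-% (c + q))) v∈))
    where
    q≤m : q ≤ m
    q≤m = ≤-trans q≤ℓ (≤-trans (m≤m+n ℓ ℓ) ℓ+ℓ≤m)
    m∸q<m : m ∸ q < m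
    m∸q<m = ∸-monoʳ-< 0<q q≤m
    ℓ≤m∸q : ℓ ≤ m ∸ q
    ℓ≤m∸q = +-cancelʳ-≤ q ℓ (m ∸ q) (subst (ℓ + q ≤_) (sym (m∸n+n≡m q≤m)) (≤-trans (+-monoʳ-≤ ℓ q≤ℓ) ℓ+ℓ≤m))
    vc≡ : v c ≡ v ((c + q) % m + (m ∸ q))
    vc≡ = trans (cong v (sym (+-identityʳ c))) (trans (v-rebase c 0 refl (m+[n∸m]≡n q≤m)) (cong (λ x → v ((c + q) % m + x)) (+-identityʳ (m ∸ q))))

  -- Window sequences inside the flower

  PetalEdges : Hypergraph n → Set
  PetalEdges H = ∀ e → Edge H e → ∃[ i ] i < m × e ≡ petal i

  module WindowStructure (H : Hypergraph n) (petal-edges : PetalEdges H) (ℓ+ℓ≤m : ℓ + ℓ ≤ m)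
                         {s : List (Fin n)} (ws : WindowSeq k H s) where

    open WindowSeq ws

    w₀ W : ℕ
    w₀ = length s ∸ k
    W = suc w₀

    length≡ : length s ≡ w₀ + k
    length≡ = sym (m∸n+n≡m nonempty)

    window : ℕ → Subset n
    window j = toSet (take k (drop j s))

    s[_] : ℕ → Fin n
    s[_] = at u s

    window-edge : ∀ {j} → j < W → Edge H (window j)
    window-edge j<W = All.lookup (map⁻ edges) (∈-upTo⁺ j<W)

    window-distinct : ∀ {i j} → i < j → j < W → window i ≢ window j
    window-distinct = Unique-applyUpTo⁻ window W (subst Unique (map-upTo window W) distinct)

    index : ℕ → ℕ
    index j with j <? W
    ... | yes j<W = proj₁ (petal-edges (window j) (window-edge j<W))
    ... | no _    = 0

    index<m : ∀ {j} → j < W → index j < m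
    index<m {j} j<W with j <? W
    ... | yes j<W' = proj₁ (proj₂ (petal-edges (window j) (window-edge j<W')))
    ... | no j≮W   = ⊥-elim (j≮W j<W)

    window≡petal : ∀ {j} → j < W → window j ≡ petal (index j)
    window≡petal {j} j<W with j <? W
    ... | yes j<W' = proj₂ (proj₂ (petal-edges (window j) (window-edge j<W')))
    ... | no j≮W   = ⊥-elim (j≮W j<W)

    index-distinct : ∀ {i j} → i < j → j < W → index i ≢ index j
    index-distinct i<j j<W eq =
      window-distinct i<j j<W (trans (window≡petal (<-trans i<j j<W)) (trans (cong petal eq) (sym (window≡petal j<W))))

    window⊆petal : ∀ j {z} → j < W → z ∈ window j → z ∈ petal (index j)
    window⊆petal j {z} j<W = subst (z ∈_) (window≡petal j<W)

    petal⊆window : ∀ j {z} → j < W → z ∈ petal (index j) → z ∈ window j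
    petal⊆window j {z} j<W = subst (z ∈_) (sym (window≡petal j<W))

    window⊆next∪first : ∀ {j z} → suc j < W → z ∈ window j → z ∈ window (suc j) ⊎ z ≡ s[ j ]
    window⊆next∪first {j} {z} 1+j<W z∈ with ∈-window⁻ u k j s (∈-toSet⁻ _ z∈)
    ... | zero , _ , _ , eq = inj₂ (trans (sym eq) (cong s[_] (+-identityʳ j)))
    ... | suc p , 1+p<k , j+1+p< , eq = inj₁ (∈-toSet⁺ _ (subst (_∈ₗ take k (drop (suc j) s))
          (trans (cong s[_] (sym (+-suc j p))) eq)
          (∈-window⁺ u k (suc j) s (<-trans (n<1+n p) 1+p<k) (subst (_< length s) (+-suc j p) j+1+p<))))

    next⊆window∪last : ∀ {j z} → suc j < W → z ∈ window (suc j) → z ∈ window j ⊎ z ≡ s[ j + k ]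
    next⊆window∪last {j} {z} 1+j<W z∈ with ∈-window⁻ u k (suc j) s (∈-toSet⁻ _ z∈)
    ... | p , p<k , 1+j+p< , eq with p ≟ ℓ
    ...   | yes refl = inj₂ (trans (sym eq) (cong s[_] (sym (+-suc j ℓ))))
    ...   | no p≢ℓ = inj₁ (∈-toSet⁺ _ (subst (_∈ₗ take k (drop j s))
          (trans (cong s[_] (+-suc j p)) eq)
          (∈-window⁺ u k j s (s≤s (≤∧≢⇒< (s≤s⁻¹ p<k) p≢ℓ)) (subst (_< length s) (sym (+-suc j p)) 1+j+p<))))

    first∉next : ∀ {j} → suc j < W → s[ j ] ∉ window (suc j)
    first∉next {j} 1+j<W s[j]∈ = index-distinct (n<1+n j) 1+j<W
      (petal⊆petal⇒≡ (index<m (<-trans (n<1+n j) 1+j<W)) (index<m 1+j<W) λ z∈ →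
        window⊆petal (suc j) 1+j<W (into-next (window⊆next∪first 1+j<W (petal⊆window j (<-trans (n<1+n j) 1+j<W) z∈))))
      where
      into-next : ∀ {z} → z ∈ window (suc j) ⊎ z ≡ s[ j ] → z ∈ window (suc j)
      into-next (inj₁ z∈) = z∈
      into-next (inj₂ refl) = s[j]∈

    last∉previous : ∀ {j} → suc j < W → s[ j + k ] ∉ window j
    last∉previous {j} 1+j<W s[j+k]∈ = index-distinct (n<1+n j) 1+j<W (sym
      (petal⊆petal⇒≡ (index<m 1+j<W) (index<m (<-trans (n<1+n j) 1+j<W)) λ z∈ →
        window⊆petal j (<-trans (n<1+n j) 1+j<W) (into-previous (next⊆window∪last 1+j<W (petal⊆window (suc j) 1+j<W z∈)))))
      where
      into-previous : ∀ {z} → z ∈ window j ⊎ z ≡ s[ j + k ] → z ∈ window j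
      into-previous (inj₁ z∈) = z∈
      into-previous (inj₂ refl) = s[j+k]∈

    first≢u : ∀ {j} → suc j < W → s[ j ] ≢ u
    first≢u {j} 1+j<W s[j]≡u =
      first∉next 1+j<W (subst (_∈ window (suc j)) (sym s[j]≡u) (petal⊆window (suc j) 1+j<W (u∈petal (index (suc j)))))

    W≤k : W ≤ k
    W≤k with ∈-window⁻ u k 0 s (∈-toSet⁻ _ (petal⊆window 0 z<s (u∈petal (index 0))))
    ... | p , p<k , _ , s[p]≡u with suc p <? W
    ...   | yes 1+p<W = ⊥-elim (first≢u 1+p<W s[p]≡u)
    ...   | no 1+p≮W  = ≤-trans (≮⇒≥ 1+p≮W) p<k

    window≡petal-% : ∀ {j} a → j < W → index j ≡ a % m → window j ≡ petal a
    window≡petal-% a j<W eq = trans (window≡petal j<W) (trans (cong petal eq) (petal-% a))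

    adjacent-windows : ∀ {j} → suc j < W → Next (index j) (index (suc j)) ⊎ Next (index (suc j)) (index j)
    adjacent-windows {j} 1+j<W =
      petal⊆petal∪⁅p⁆⇒Next ℓ+ℓ≤m s[ j ] (index<m j<W) (index<m 1+j<W) (index-distinct (n<1+n j) 1+j<W)
        λ z∈ → Sum.map₁ (window⊆petal (suc j) 1+j<W) (window⊆next∪first 1+j<W (petal⊆window j j<W z∈))
      where
      j<W : j < W
      j<W = <-trans (n<1+n j) 1+j<W

    Forwards Backwards : Set
    Forwards  = ∀ {j} → suc j < W → Next (index j) (index (suc j))
    Backwards = ∀ {j} → suc j < W → Next (index (suc j)) (index j)

    forwards : Next (index 0) (index 1) → Forwards
    forwards next₀ {zero}  _      = next₀
    forwards next₀ {suc j} 2+j<W with adjacent-windows 2+j<W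
    ... | inj₁ next = next
    ... | inj₂ back = ⊥-elim (index-distinct (m<n+m j z<s) 2+j<W
          (Next-injectiveˡ (index<m (<-trans (m<n+m j z<s) 2+j<W)) (index<m 2+j<W) (forwards next₀ 1+j<W) back))
      where
      1+j<W : suc j < W
      1+j<W = <-trans (n<1+n (suc j)) 2+j<W

    backwards : Next (index 1) (index 0) → Backwards
    backwards back₀ {zero}  _      = back₀
    backwards back₀ {suc j} 2+j<W with adjacent-windows 2+j<W
    ... | inj₂ back = back
    ... | inj₁ next = ⊥-elim (index-distinct (m<n+m j z<s) 2+j<W
          (trans (backwards back₀ (<-trans (n<1+n (suc j)) 2+j<W)) (sym next)))

    direction : Forwards ⊎ Backwards
    direction with 0 <? w₀
    ... | no 0≮w₀ = inj₁ λ {j} 1+j<W → ⊥-elim (0≮w₀ (<-≤-trans z<s (s≤s⁻¹ 1+j<W)))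
    ... | yes 0<w₀ with adjacent-windows (s≤s 0<w₀)
    ...   | inj₁ next₀ = inj₁ (forwards next₀)
    ...   | inj₂ back₀ = inj₂ (backwards back₀)

    index-forwards : Forwards → ∀ {j} → j < W → index j ≡ (index 0 + j) % m
    index-forwards fw {zero}  0<W   = sym (trans (cong (_% m) (+-identityʳ (index 0))) (m<n⇒m%n≡m (index<m 0<W)))
    index-forwards fw {suc j} 1+j<W = begin
      index (suc j)                      ≡⟨ fw 1+j<W ⟩
      (index j + 1) % m                  ≡⟨ cong (λ x → (x + 1) % m) (index-forwards fw (<-trans (n<1+n j) 1+j<W)) ⟩
      ((index 0 + j) % m + 1) % m        ≡⟨ [m%d+n]%d≡[m+n]%d (index 0 + j) 1 m ⟩
      (index 0 + j + 1) % m              ≡⟨ cong (_% m) (trans (+-assoc (index 0) j 1) (cong (index 0 +_) (+-comm j 1))) ⟩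
      (index 0 + suc j) % m              ∎
      where open ≡-Reasoning

    index-backwards : Backwards → ∀ r {j} → j + r ≡ w₀ → index j ≡ (index w₀ + r) % m
    index-backwards bw zero {j} j+0≡w₀ rewrite +-identityʳ j | j+0≡w₀ =
      sym (trans (cong (_% m) (+-identityʳ (index w₀))) (m<n⇒m%n≡m (index<m (n<1+n w₀))))
    index-backwards bw (suc r) {j} j+1+r≡w₀ = begin
      index j                            ≡⟨ bw 1+j<W ⟩
      (index (suc j) + 1) % m            ≡⟨ cong (λ x → (x + 1) % m) (index-backwards bw r (trans (sym (+-suc j r)) j+1+r≡w₀)) ⟩
      ((index w₀ + r) % m + 1) % m       ≡⟨ [m%d+n]%d≡[m+n]%d (index w₀ + r) 1 m ⟩
      (index w₀ + r + 1) % m             ≡⟨ cong (_% m) (trans (+-assoc (index w₀) r 1) (cong (index w₀ +_) (+-comm r 1))) ⟩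
      (index w₀ + suc r) % m             ∎
      where
      open ≡-Reasoning
      1+j<W : suc j < W
      1+j<W = s≤s (subst (suc j ≤_) (trans (sym (+-suc j r)) j+1+r≡w₀) (m≤m+n (suc j) r))

    WindowsOnArc : ℕ → Set
    WindowsOnArc c = (∀ {t} → t < W → ∃[ j ] j < W × index j ≡ (c + t) % m)
                   × (∀ {j} → j < W → ∃[ t ] t < W × index j ≡ (c + t) % m)

    windows-on-arc : ∃[ c ] WindowsOnArc c
    windows-on-arc with direction
    ... | inj₁ fw = index 0 , (λ {t} t<W → t , t<W , index-forwards fw t<W) , (λ {j} j<W → j , j<W , index-forwards fw j<W)
    ... | inj₂ bw = index w₀
        , (λ {t} t<W → w₀ ∸ t , s≤s (m∸n≤m w₀ t) , index-backwards bw t (m∸n+n≡m (s≤s⁻¹ t<W)))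
        , (λ {j} j<W → w₀ ∸ j , s≤s (m∸n≤m w₀ j) , index-backwards bw (w₀ ∸ j) (m+[n∸m]≡n (s≤s⁻¹ j<W)))

    c : ℕ
    c = proj₁ windows-on-arc

    arc-edge : ∀ {t} → t < W → Edge H (petal ((c + t) % m))
    arc-edge t<W with j , j<W , eq ← proj₁ (proj₂ windows-on-arc) t<W =
      subst (Edge H) (trans (window≡petal j<W) (cong petal eq)) (window-edge j<W)

    at∈window : ∀ {p} → p < length s → ∃[ j ] j < W × s[ p ] ∈ window j
    at∈window {p} p<l with p <? W
    ... | yes p<W = p , p<W , ∈-toSet⁺ _ (subst (_∈ₗ take k (drop p s)) (cong s[_] (+-identityʳ p))
                      (∈-window⁺ u k p s z<s (subst (_< length s) (sym (+-identityʳ p)) p<l)))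
    ... | no p≮W = w₀ , n<1+n w₀ , ∈-toSet⁺ _ (subst (_∈ₗ take k (drop w₀ s)) (cong s[_] w₀+[p∸w₀]≡p)
                      (∈-window⁺ u k w₀ s p∸w₀<k (subst (_< length s) (sym w₀+[p∸w₀]≡p) p<l)))
      where
      w₀+[p∸w₀]≡p : w₀ + (p ∸ w₀) ≡ p
      w₀+[p∸w₀]≡p = m+[n∸m]≡n (<⇒≤ (≮⇒≥ p≮W))
      p∸w₀<k : p ∸ w₀ < k
      p∸w₀<k = +-cancelˡ-< w₀ (p ∸ w₀) k (subst (_< w₀ + k) (sym w₀+[p∸w₀]≡p) (subst (p <_) length≡ p<l))

    ∈-on-arc : ∀ {z} → z ∈ₗ s → z ≡ u ⊎ ∃[ t ] t < w₀ + ℓ × toℕ z ≡ (c + t) % m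
    ∈-on-arc {z} z∈s with ∈⇒at u s z∈s
    ... | p , p<l , s[p]≡z with at∈window p<l
    ... | j , j<W , s[p]∈ with ∈-petal⁻ (index j) (window⊆petal j j<W (subst (_∈ window j) s[p]≡z s[p]∈))
    ... | inj₁ z≡m = inj₁ (toℕ-injective (trans z≡m (sym toℕ-u)))
    ... | inj₂ (t' , t'<ℓ , z≡) with t , t<W , index≡ ← proj₂ (proj₂ windows-on-arc) j<W =
      inj₂ (t + t' , +-mono-≤-< (s≤s⁻¹ t<W) t'<ℓ , (begin
        toℕ z                        ≡⟨ z≡ ⟩
        (index j + t') % m           ≡⟨ cong (λ x → (x + t') % m) index≡ ⟩
        ((c + t) % m + t') % m       ≡⟨ [m%d+n]%d≡[m+n]%d (c + t) t' m ⟩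
        (c + t + t') % m             ≡⟨ cong (_% m) (+-assoc c t t') ⟩
        (c + (t + t')) % m           ∎))
      where open ≡-Reasoning

    v∈⇒on-arc : ∀ a → v a ∈ₗ s → ∃[ t ] t < w₀ + ℓ × a % m ≡ (c + t) % m
    v∈⇒on-arc a va∈ with ∈-on-arc va∈
    ... | inj₁ va≡u = ⊥-elim (v≢u a va≡u)
    ... | inj₂ (t , t< , va≡) = t , t< , trans (sym (toℕ-v a)) va≡

    w₀+ℓ≤ℓ+ℓ : w₀ + ℓ ≤ ℓ + ℓ
    w₀+ℓ≤ℓ+ℓ = +-monoˡ-≤ ℓ (s≤s⁻¹ W≤k)

    first∈window : s[ 0 ] ∈ window 0
    first∈window = ∈-toSet⁺ _ (∈-window⁺ u k 0 s z<s (<-≤-trans z<s nonempty))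

    last∈window : s[ w₀ + ℓ ] ∈ window w₀
    last∈window = ∈-toSet⁺ _ (∈-window⁺ u k w₀ s (n<1+n ℓ) (subst (w₀ + ℓ <_) (sym (trans length≡ (+-suc w₀ ℓ))) (n<1+n _)))

    head≡last⇒first≡last : head s ≡ last s → s[ 0 ] ≡ s[ w₀ + ℓ ]
    head≡last⇒first≡last eq = trans (head≡last⇒at≡at u s (<-≤-trans z<s nonempty) eq)
      (cong s[_] (trans (cong (_∸ 1) length≡) (cong (_∸ 1) (+-suc w₀ ℓ))))

    -- otherwise the k distinct vertices of the first window would sit at the ℓ positions 0, …, ℓ − 1
    s[0]≢s[ℓ] : s[ 0 ] ≢ s[ ℓ ]
    s[0]≢s[ℓ] s[0]≡s[ℓ] = collision (pigeonhole (n<1+n ℓ) (λ y → proj₁ (position y)))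
      where
      petal-vertex : Fin k → Fin n
      petal-vertex Fin.zero    = u
      petal-vertex (Fin.suc t) = v (index 0 + toℕ t)

      petal-vertex-injective : ∀ i j → petal-vertex i ≡ petal-vertex j → i ≡ j
      petal-vertex-injective Fin.zero    Fin.zero    _  = refl
      petal-vertex-injective Fin.zero    (Fin.suc t) eq = ⊥-elim (v≢u (index 0 + toℕ t) (sym eq))
      petal-vertex-injective (Fin.suc t) Fin.zero    eq = ⊥-elim (v≢u (index 0 + toℕ t) eq)
      petal-vertex-injective (Fin.suc a) (Fin.suc b) eq =
        cong Fin.suc (toℕ-injective (v-cancel (index 0) (<-trans (toℕ<n a) ℓ<m) (<-trans (toℕ<n b) ℓ<m) eq))

      petal-vertex∈ : ∀ y → petal-vertex y ∈ petal (index 0)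
      petal-vertex∈ Fin.zero    = u∈petal (index 0)
      petal-vertex∈ (Fin.suc t) = v∈petal⁺ (index 0) (toℕ<n t)

      position : ∀ y → ∃[ q ] s[ toℕ {ℓ} q ] ≡ petal-vertex y
      position y with ∈-window⁻ u k 0 s (∈-toSet⁻ _ (petal⊆window 0 z<s (petal-vertex∈ y)))
      ... | p , p<k , _ , s[p]≡ with p ≟ ℓ
      ...   | yes refl = Fin.zero , trans s[0]≡s[ℓ] s[p]≡
      ...   | no p≢ℓ   = fromℕ< p<ℓ , trans (cong s[_] (toℕ-fromℕ< p<ℓ)) s[p]≡
        where
        p<ℓ : p < ℓ
        p<ℓ = ≤∧≢⇒< (s≤s⁻¹ p<k) p≢ℓ

      collision : ∃₂ (λ i j → i Fin.< j × proj₁ (position i) ≡ proj₁ (position j)) → ⊥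
      collision (i , j , i<j , pos≡) = Fin.<⇒≢ i<j (petal-vertex-injective i j
        (trans (sym (proj₂ (position i))) (trans (cong (λ q → s[ toℕ q ]) pos≡) (proj₂ (position j)))))

    forwards-no-semicycle : Forwards → 0 < w₀ → s[ 0 ] ≢ s[ w₀ + ℓ ]
    forwards-no-semicycle fw 0<w₀ s[0]≡last = v∉petal-ahead ℓ+ℓ≤m (index 0) 0<w₀ (s≤s⁻¹ W≤k)
      (subst (_∈ petal (index 0 + w₀)) (trans (sym s[0]≡last) s[0]≡v)
        (subst (s[ w₀ + ℓ ] ∈_) (window≡petal-% (index 0 + w₀) (n<1+n w₀) (index-forwards fw (n<1+n w₀))) last∈window))
      where
      s[0]≡v : s[ 0 ] ≡ v (index 0)
      s[0]≡v = petal∖next⇒≡v (index 0) (window⊆petal 0 z<s first∈window)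
        (λ ∈next → first∉next (s≤s 0<w₀) (subst (s[ 0 ] ∈_) (sym (window≡petal-% (index 0 + 1) (s≤s 0<w₀) (index-forwards fw (s≤s 0<w₀)))) ∈next))

    backwards-no-semicycle : Backwards → ∀ {j} → suc j ≡ w₀ → s[ 0 ] ≢ s[ w₀ + ℓ ]
    backwards-no-semicycle bw {j} 1+j≡w₀ s[0]≡last = v∉petal-ahead ℓ+ℓ≤m (index w₀) 0<w₀ (s≤s⁻¹ W≤k)
      (subst (_∈ petal (index w₀ + w₀)) (trans s[0]≡last last≡v)
        (subst (s[ 0 ] ∈_) (window≡petal-% (index w₀ + w₀) z<s (index-backwards bw w₀ refl)) first∈window))
      where
      0<w₀ : 0 < w₀
      0<w₀ = subst (0 <_) 1+j≡w₀ z<s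
      1+j<W : suc j < W
      1+j<W = s≤s (≤-reflexive 1+j≡w₀)
      last≡v : s[ w₀ + ℓ ] ≡ v (index w₀)
      last≡v = petal∖next⇒≡v (index w₀) (window⊆petal w₀ (n<1+n w₀) last∈window) λ ∈next →
        last∉previous 1+j<W (subst (_∈ window j) (cong s[_] (sym (trans (+-suc j ℓ) (cong (_+ ℓ) 1+j≡w₀))))
          (subst (s[ w₀ + ℓ ] ∈_) (sym (window≡petal-% (index w₀ + 1) (<-trans (n<1+n j) 1+j<W) (index-backwards bw 1 (trans (+-comm j 1) 1+j≡w₀)))) ∈next))

    first≢last : s[ 0 ] ≢ s[ w₀ + ℓ ]
    first≢last with 0 <? w₀ | direction
    ... | no 0≮w₀  | _      = subst (λ w → s[ 0 ] ≢ s[ w + ℓ ]) (sym w₀≡0) s[0]≢s[ℓ]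
      where
      w₀≡0 : w₀ ≡ 0
      w₀≡0 = n≤0⇒n≡0 (≮⇒≥ 0≮w₀)
    ... | yes 0<w₀ | inj₁ fw = forwards-no-semicycle fw 0<w₀
    ... | yes 0<w₀ | inj₂ bw = backwards-no-semicycle bw (suc-pred w₀ {{>-nonZero 0<w₀}})

  semicycle-free : ∀ {H} → PetalEdges H → ℓ + ℓ ≤ m → SemicycleFree k H
  semicycle-free {H} petal-edges ℓ+ℓ≤m s (ws , head≡last) = first≢last (head≡last⇒first≡last head≡last)
    where open WindowStructure H petal-edges ℓ+ℓ≤m ws

  -- Chains along arcs

  -- v c, …, v (c + w − 1), u, v (c + w), …, v (c + w + ℓ − 1), whose windows are the petals c, …, c + w
  module ArcSequence (c w : ℕ) (w≤ℓ : w ≤ ℓ) (w<m : w < m) where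

    L : ℕ
    L = suc w + ℓ

    entry : ℕ → Fin n
    entry p with <-cmp p w
    ... | tri< _ _ _ = v (c + p)
    ... | tri≈ _ _ _ = u
    ... | tri> _ _ _ = v (c + pred p)

    entry-< : ∀ {p} → p < w → entry p ≡ v (c + p)
    entry-< {p} p<w with <-cmp p w
    ... | tri< _ _ _    = refl
    ... | tri≈ _ p≡w _  = ⊥-elim (<-irrefl p≡w p<w)
    ... | tri> _ _ w<p  = ⊥-elim (<-asym p<w w<p)

    entry-≡ : entry w ≡ u
    entry-≡ with <-cmp w w
    ... | tri< w<w _ _ = ⊥-elim (<-irrefl refl w<w)
    ... | tri≈ _ _ _   = refl
    ... | tri> _ _ w<w = ⊥-elim (<-irrefl refl w<w)

    entry-> : ∀ {p} → w < p → entry p ≡ v (c + pred p)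
    entry-> {p} w<p with <-cmp p w
    ... | tri< p<w _ _ = ⊥-elim (<-asym p<w w<p)
    ... | tri≈ _ p≡w _ = ⊥-elim (<-irrefl (sym p≡w) w<p)
    ... | tri> _ _ _   = refl

    sequence : List (Fin n)
    sequence = applyUpTo entry L

    length-sequence : length sequence ≡ L
    length-sequence = length-applyUpTo entry L

    at-sequence : ∀ {p} → p < L → at u sequence p ≡ entry p
    at-sequence p<L = at-applyUpTo u entry L p<L

    entry∈ : ∀ {p} → p < L → entry p ∈ₗ sequence
    entry∈ p<L = ∈-applyUpTo⁺ entry p<L

    window : ℕ → Subset n
    window j = toSet (take k (drop j sequence))

    entry∈window : ∀ j p → p < k → j + p < L → entry (j + p) ∈ window j
    entry∈window j p p<k j+p<L = ∈-toSet⁺ _ (subst (_∈ₗ take k (drop j sequence)) (at-sequence j+p<L)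
      (∈-window⁺ u k j sequence p<k (subst (j + p <_) (sym length-sequence) j+p<L)))

    arc∈petal : ∀ j {t} → t < ℓ → v (c + (j + t)) ∈ petal ((c + j) % m)
    arc∈petal j {t} t<ℓ = subst (_∈ petal ((c + j) % m)) (v-shift c j t) (v∈petal⁺ ((c + j) % m) t<ℓ)

    entry∈petal : ∀ j p → j ≤ w → p < k → entry (j + p) ∈ petal ((c + j) % m)
    entry∈petal j p j≤w p<k with <-cmp w (j + p)
    ... | tri> _ _ j+p<w = subst (_∈ petal ((c + j) % m)) (sym (entry-< j+p<w))
      (arc∈petal j (≤-<-trans (m≤n+m p j) (<-≤-trans j+p<w w≤ℓ)))
    ... | tri≈ _ w≡j+p _ = subst (_∈ petal ((c + j) % m)) (sym (trans (cong entry (sym w≡j+p)) entry-≡)) (u∈petal ((c + j) % m))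
    ... | tri< w<j+p _ _ = subst (_∈ petal ((c + j) % m)) (sym (entry-> w<j+p)) (before-u p p<k w<j+p)
      where
      before-u : ∀ p → p < k → w < j + p → v (c + pred (j + p)) ∈ petal ((c + j) % m)
      before-u zero    _          w<j+0 = ⊥-elim (<⇒≱ w<j+0 (subst (_≤ w) (sym (+-identityʳ j)) j≤w))
      before-u (suc p) (s≤s p<ℓ) _     = subst (λ x → v (c + pred x) ∈ petal ((c + j) % m)) (sym (+-suc j p)) (arc∈petal j p<ℓ)

    window⊆petal : ∀ {j z} → j ≤ w → z ∈ window j → z ∈ petal ((c + j) % m)
    window⊆petal {j} j≤w z∈ with ∈-window⁻ u k j sequence (∈-toSet⁻ _ z∈)
    ... | p , p<k , j+p< , at≡z = subst (_∈ petal ((c + j) % m))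
      (trans (sym (at-sequence (subst (j + p <_) length-sequence j+p<))) at≡z) (entry∈petal j p j≤w p<k)

    petal⊆window : ∀ {j z} → j ≤ w → z ∈ petal ((c + j) % m) → z ∈ window j
    petal⊆window {j} {z} j≤w z∈ with ∈-petal⁻ ((c + j) % m) z∈
    ... | inj₁ z≡m = subst (_∈ window j) (trans (cong entry j+[w∸j]≡w) (trans entry-≡ (toℕ-injective (trans toℕ-u (sym z≡m)))))
      (entry∈window j (w ∸ j) (s≤s (≤-trans (m∸n≤m w j) w≤ℓ)) (subst (_< L) (sym j+[w∸j]≡w) (m≤m+n (suc w) ℓ)))
      where
      j+[w∸j]≡w : j + (w ∸ j) ≡ w
      j+[w∸j]≡w = m+[n∸m]≡n j≤w
    ... | inj₂ (t , t<ℓ , z≡) = subst (_∈ window j) (sym z≡v) v∈window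
      where
      z≡v : z ≡ v (c + (j + t))
      z≡v = toℕ-injective (trans z≡ (trans ([m%d+n]%d≡[m+n]%d (c + j) t m)
              (trans (cong (_% m) (+-assoc c j t)) (sym (toℕ-v (c + (j + t)))))))
      j+t<w+ℓ : j + t < w + ℓ
      j+t<w+ℓ = +-mono-≤-< j≤w t<ℓ
      after-u : entry (j + suc t) ∈ window j
      after-u = entry∈window j (suc t) (s≤s t<ℓ) (subst (_< L) (sym (+-suc j t)) (s≤s j+t<w+ℓ))
      v∈window : v (c + (j + t)) ∈ window j
      v∈window with <-cmp (j + t) w
      ... | tri< j+t<w _ _ = subst (_∈ window j) (entry-< j+t<w)
          (entry∈window j t (<-trans t<ℓ (n<1+n ℓ)) (<-trans j+t<w+ℓ (n<1+n _)))
      ... | tri≈ _ j+t≡w _ = subst (_∈ window j) (trans (cong entry (+-suc j t)) (entry-> (s≤s (≤-reflexive (sym j+t≡w))))) after-u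
      ... | tri> _ _ w<j+t = subst (_∈ window j) (trans (cong entry (+-suc j t)) (entry-> (<-trans w<j+t (n<1+n _)))) after-u

    window≡petal : ∀ {j} → j ≤ w → window j ≡ petal ((c + j) % m)
    window≡petal j≤w = ⊆-antisym (window⊆petal j≤w) (petal⊆window j≤w)

    windows≡ : windows k sequence ≡ applyUpTo window (suc w)
    windows≡ = trans (cong (λ x → map window (upTo (suc x))) length∸k) (map-upTo window (suc w))
      where
      length∸k : length sequence ∸ k ≡ w
      length∸k = trans (cong (_∸ k) (trans length-sequence (sym (+-suc w ℓ)))) (m+n∸n≡m w k)

    window-injective : ∀ {i j} → i < j → j ≤ w → window i ≢ window j
    window-injective {i} {j} i<j j≤w eq = <⇒≢ i<j (+-cancelˡ-% c i<m j<m (petal-injective (m%n<n (c + i) m) (m%n<n (c + j) m)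
      (trans (sym (window≡petal (<⇒≤ (<-≤-trans i<j j≤w)))) (trans eq (window≡petal j≤w)))))
      where
      j<m : j < m
      j<m = ≤-<-trans j≤w w<m
      i<m : i < m
      i<m = <-trans i<j j<m

    window-seq : (H : Hypergraph n) → (∀ x → Vert H x) → (∀ {j} → j ≤ w → Edge H (petal ((c + j) % m))) →
                 WindowSeq k H sequence
    window-seq H all-vertices arc-edges = record
      { nonempty = subst (k ≤_) (sym length-sequence) (s≤s (m≤n+m ℓ w))
      ; verts    = All.tabulate (λ {x} _ → all-vertices x)
      ; edges    = subst (All (Edge H)) (sym windows≡)
                     (applyUpTo⁺₁ window (suc w) λ {j} j≤w → subst (Edge H) (sym (window≡petal (s≤s⁻¹ j≤w))) (arc-edges (s≤s⁻¹ j≤w)))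
      ; distinct = subst Unique (sym windows≡) (Unique.applyUpTo⁺₁ window (suc w) λ i<j j<1+w → window-injective i<j (s≤s⁻¹ j<1+w))
      }

    last-sequence : last sequence ≡ just (entry (w + ℓ))
    last-sequence = trans (last≡at u (entry 0) (applyUpTo (λ i → entry (suc i)) (w + ℓ)))
      (cong just (trans (cong (at u sequence) (length-applyUpTo (λ i → entry (suc i)) (w + ℓ))) (at-sequence (n<1+n _))))

    u∈sequence : u ∈ₗ sequence
    u∈sequence = subst (_∈ₗ sequence) entry-≡ (entry∈ (m≤m+n (suc w) ℓ))

    v∈sequence : ∀ {t} → t < w + ℓ → v (c + t) ∈ₗ sequence
    v∈sequence {t} t<w+ℓ with <-cmp t w
    ... | tri< t<w _ _ = subst (_∈ₗ sequence) (entry-< t<w) (entry∈ (<-trans t<w+ℓ (n<1+n _)))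
    ... | tri≈ _ t≡w _ = subst (_∈ₗ sequence) (entry-> (s≤s (≤-reflexive (sym t≡w)))) (entry∈ (s≤s t<w+ℓ))
    ... | tri> _ _ w<t = subst (_∈ₗ sequence) (entry-> (<-trans w<t (n<1+n t))) (entry∈ (s≤s t<w+ℓ))

  module ArcChain (ℓ+ℓ≤m : ℓ + ℓ ≤ m) (c : ℕ) where
    open ArcSequence c ℓ ≤-refl ℓ<m public

    head≢last : head sequence ≢ last sequence
    head≢last head≡last = <-irrefl 0≡pred[ℓ+ℓ] (<-≤-trans z<s (s≤s⁻¹ ℓ<ℓ+ℓ))
      where
      ℓ<ℓ+ℓ : ℓ < ℓ + ℓ
      ℓ<ℓ+ℓ = m<m+n ℓ z<s
      first≡last : v (c + 0) ≡ v (c + pred (ℓ + ℓ))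
      first≡last = trans (sym (entry-< z<s)) (trans (just-injective (trans head≡last last-sequence)) (entry-> ℓ<ℓ+ℓ))
      0≡pred[ℓ+ℓ] : 0 ≡ pred (ℓ + ℓ)
      0≡pred[ℓ+ℓ] = v-cancel c (<-trans z<s ℓ<m) (<-≤-trans (pred-< ℓ<ℓ+ℓ) ℓ+ℓ≤m) first≡last
        where
        pred-< : ∀ {a b} → a < b → pred b < b
        pred-< {b = suc b} _ = n<1+n b

    chain : (H : Hypergraph n) → (∀ x → Vert H x) → (∀ {j} → j ≤ ℓ → Edge H (petal ((c + j) % m))) →
            IsChainIn k H sequence
    chain H all-vertices arc-edges = window-seq H all-vertices arc-edges , head≢last

  OnSpan : ℕ → ℕ → Set
  OnSpan c a = ∃[ t ] t < ℓ + ℓ × v a ≡ v (c + t)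

  chain-connected-by-arcs : ℓ + ℓ ≤ m → (H : Hypergraph n) → (∀ x → Vert H x) → (Good : ℕ → Set) →
    (∀ {c} → Good c → ∀ {j} → j ≤ ℓ → Edge H (petal ((c + j) % m))) →
    (∀ {a b} → a ≤ b → b < m → ∃[ c ] Good c × OnSpan c a × OnSpan c b) →
    ChainConnected k H
  chain-connected-by-arcs ℓ+ℓ≤m H all-vertices Good arc-edges spanned = connect
    where
    Joined : Fin n → Fin n → Set
    Joined x y = ∃[ s ] IsChainIn k H s × x ∈ₗ s × y ∈ₗ s

    swap : ∀ {x y} → Joined x y → Joined y x
    swap (s , chain , x∈ , y∈) = s , chain , y∈ , x∈

    joined : ∀ {a b} → a ≤ b → b < m → Joined (v a) (v b) × Joined u (v b)
    joined {a} {b} a≤b b<m with c , good , (t₁ , t₁< , va≡) , (t₂ , t₂< , vb≡) ← spanned a≤b b<m =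
        (sequence , chain H all-vertices (arc-edges good) , a∈ , b∈)
      , (sequence , chain H all-vertices (arc-edges good) , u∈sequence , b∈)
      where
      open ArcChain ℓ+ℓ≤m c
      a∈ : v a ∈ₗ sequence
      a∈ = subst (_∈ₗ sequence) (sym va≡) (v∈sequence t₁<)
      b∈ : v b ∈ₗ sequence
      b∈ = subst (_∈ₗ sequence) (sym vb≡) (v∈sequence t₂<)

    connect : ChainConnected k H
    connect x y _ _ x≢y with vertex-cases x | vertex-cases y
    ... | inj₁ refl | inj₁ refl = ⊥-elim (x≢y refl)
    ... | inj₁ refl | inj₂ (b , b<m , refl) = proj₂ (joined ≤-refl b<m)
    ... | inj₂ (a , a<m , refl) | inj₁ refl = swap (proj₂ (joined ≤-refl a<m))
    ... | inj₂ (a , a<m , refl) | inj₂ (b , b<m , refl) with ≤-total a b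
    ...   | inj₁ a≤b = proj₁ (joined a≤b b<m)
    ...   | inj₂ b≤a = swap (proj₁ (joined b≤a a<m))

  on-span : ∀ c a → c ≤ a → a ∸ c < ℓ + ℓ → OnSpan c a
  on-span c a c≤a a∸c< = a ∸ c , a∸c< , cong v (sym (m+[n∸m]≡n c≤a))

  on-span-wrapped : ∀ c a → c ≤ m → m ∸ c + a < ℓ + ℓ → OnSpan c a
  on-span-wrapped c a c≤m wrapped< = m ∸ c + a , wrapped< , %≡%⇒v≡v a (c + (m ∸ c + a)) (sym (begin
    (c + (m ∸ c + a)) % m   ≡⟨ cong (_% m) (+-assoc c (m ∸ c) a) ⟨
    (c + (m ∸ c) + a) % m   ≡⟨ cong (λ x → (x + a) % m) (m+[n∸m]≡n c≤m) ⟩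
    (m + a) % m             ≡⟨ cong (_% m) (+-comm m a) ⟩
    (a + m) % m             ≡⟨ [m+n]%n≡m%n a m ⟩
    a % m                   ∎))
    where open ≡-Reasoning

  close-or-wrapped : m < (ℓ + ℓ) + (ℓ + ℓ) → ∀ {a b} → a ≤ b → b < m →
                     b ∸ a < ℓ + ℓ ⊎ (ℓ + ℓ ≤ b ∸ a × m ∸ b + a < ℓ + ℓ)
  close-or-wrapped m<4ℓ {a} {b} a≤b b<m with b ∸ a <? ℓ + ℓ | m ∸ b + a <? ℓ + ℓ
  ... | yes close | _           = inj₁ close
  ... | no far    | yes wrapped = inj₂ (≮⇒≥ far , wrapped)
  ... | no far    | no far'     = ⊥-elim (<⇒≱ m<4ℓ (subst ((ℓ + ℓ) + (ℓ + ℓ) ≤_) around (+-mono-≤ (≮⇒≥ far') (≮⇒≥ far))))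
    where
    around : m ∸ b + a + (b ∸ a) ≡ m
    around = trans (+-assoc (m ∸ b) a (b ∸ a)) (trans (cong (m ∸ b +_) (m+[n∸m]≡n a≤b)) (m∸n+n≡m (<⇒≤ b<m)))

  on-span-self : ∀ a → OnSpan a a
  on-span-self a = on-span a a ≤-refl (subst (_< ℓ + ℓ) (sym (n∸n≡0 a)) (<-trans z<s ℓ<ℓ+ℓ))
    where
    ℓ<ℓ+ℓ : ℓ < ℓ + ℓ
    ℓ<ℓ+ℓ = m<m+n ℓ z<s

  flower-petal-edges : PetalEdges (flower k n)
  flower-petal-edges _ e∈ = e∈

  flower-arc-edge : ∀ i → Edge (flower k n) (petal (i % m))
  flower-arc-edge i = i % m , m%n<n i m , refl

  flower-chain-connected : ℓ + ℓ ≤ m → m < (ℓ + ℓ) + (ℓ + ℓ) → ChainConnected k (flower k n)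
  flower-chain-connected ℓ+ℓ≤m m<4ℓ =
    chain-connected-by-arcs ℓ+ℓ≤m (flower k n) (λ _ → tt) (λ _ → ⊤) (λ {c} _ {j} _ → flower-arc-edge (c + j)) spanned
    where
    spanned : ∀ {a b} → a ≤ b → b < m → ∃[ c ] ⊤ × OnSpan c a × OnSpan c b
    spanned {a} {b} a≤b b<m with close-or-wrapped m<4ℓ a≤b b<m
    ... | inj₁ close   = a , tt , on-span-self a , on-span a b a≤b close
    ... | inj₂ (_ , wrapped) = b , tt , on-span-wrapped b a (<⇒≤ b<m) wrapped , on-span-self b

  flower-not-semicycle-free : m < ℓ + ℓ → ¬ SemicycleFree k (flower k n)
  flower-not-semicycle-free m<ℓ+ℓ free =
    free sequence (window-seq (flower k n) (λ _ → tt) (λ {j} _ → flower-arc-edge (0 + j)) , head≡last)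
    where
    d : ℕ
    d = m ∸ ℓ
    ℓ+d≡m : ℓ + d ≡ m
    ℓ+d≡m = m+[n∸m]≡n (<⇒≤ ℓ<m)
    1+d≤ℓ : suc d ≤ ℓ
    1+d≤ℓ = +-cancelˡ-≤ ℓ (suc d) ℓ (subst (_≤ ℓ + ℓ) (sym (+-suc ℓ d)) (subst (λ x → suc x ≤ ℓ + ℓ) (sym ℓ+d≡m) m<ℓ+ℓ))
    1+d<m : suc d < m
    1+d<m = subst (suc (suc d) ≤_) ℓ+d≡m (+-monoˡ-≤ d (s≤s (s≤s z≤n)))
    open ArcSequence 0 (suc d) 1+d≤ℓ 1+d<m
    head≡last : head sequence ≡ last sequence
    head≡last = trans (cong just (trans (entry-< z<s) (trans v0≡vm (sym (entry-> (m<m+n (suc d) z<s)))))) (sym last-sequence)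
      where
      v0≡vm : v (0 + 0) ≡ v (0 + (d + ℓ))
      v0≡vm = %≡%⇒v≡v 0 (d + ℓ) (sym (trans (cong (_% m) (trans (+-comm d ℓ) ℓ+d≡m)) (n%n≡0 m)))

  span-diameter : (ℓ + ℓ) + (ℓ + ℓ) ≤ m → ∀ c {t₁ t₂} → t₁ < ℓ + ℓ → t₂ < ℓ + ℓ →
                  (c + t₁) % m ≡ 0 → (c + t₂) % m ≢ ℓ + ℓ
  span-diameter 4ℓ≤m c {t₁} {t₂} t₁< t₂< at-0 at-2ℓ with ≤-total t₁ t₂
  ... | inj₁ t₁≤t₂ = <-irrefl (sym (begin
    ℓ + ℓ                       ≡⟨ at-2ℓ ⟨
    (c + t₂) % m                ≡⟨ [c+b]%d≡[[c+a]%d+[b∸a]]%d c m t₁≤t₂ ⟩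
    ((c + t₁) % m + (t₂ ∸ t₁)) % m ≡⟨ cong (λ x → (x + (t₂ ∸ t₁)) % m) at-0 ⟩
    (t₂ ∸ t₁) % m               ≡⟨ m<n⇒m%n≡m (<-≤-trans gap< (≤-trans (m≤m+n (ℓ + ℓ) (ℓ + ℓ)) 4ℓ≤m)) ⟩
    t₂ ∸ t₁                     ∎)) gap<
    where
    open ≡-Reasoning
    gap< : t₂ ∸ t₁ < ℓ + ℓ
    gap< = ≤-<-trans (m∸n≤m t₂ t₁) t₂<
  ... | inj₂ t₂≤t₁ = 0≢1+n (begin
    0                           ≡⟨ at-0 ⟨
    (c + t₁) % m                ≡⟨ [c+b]%d≡[[c+a]%d+[b∸a]]%d c m t₂≤t₁ ⟩
    ((c + t₂) % m + (t₁ ∸ t₂)) % m ≡⟨ cong (λ x → (x + (t₁ ∸ t₂)) % m) at-2ℓ ⟩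
    (ℓ + ℓ + (t₁ ∸ t₂)) % m     ≡⟨ m<n⇒m%n≡m (<-≤-trans (+-monoʳ-< (ℓ + ℓ) (≤-<-trans (m∸n≤m t₁ t₂) t₁<)) 4ℓ≤m) ⟩
    ℓ + ℓ + (t₁ ∸ t₂)           ∎)
    where open ≡-Reasoning

  flower-not-chain-connected : (ℓ + ℓ) + (ℓ + ℓ) ≤ m → ¬ ChainConnected k (flower k n)
  flower-not-chain-connected 4ℓ≤m connected = no-chain (connected (v 0) (v (ℓ + ℓ)) tt tt v0≢v2ℓ)
    where
    2ℓ<m : ℓ + ℓ < m
    2ℓ<m = <-≤-trans (m<m+n (ℓ + ℓ) z<s) 4ℓ≤m
    v0≢v2ℓ : v 0 ≢ v (ℓ + ℓ)
    v0≢v2ℓ eq = 0≢1+n (v-cancel 0 z<s 2ℓ<m eq)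
    no-chain : ∃[ s ] IsChainIn k (flower k n) s × v 0 ∈ₗ s × v (ℓ + ℓ) ∈ₗ s → ⊥
    no-chain (s , (ws , _) , v0∈ , v2ℓ∈) = apart (v∈⇒on-arc 0 v0∈) (v∈⇒on-arc (ℓ + ℓ) v2ℓ∈)
      where
      open WindowStructure (flower k n) flower-petal-edges (<⇒≤ 2ℓ<m) ws
      apart : ∃[ t ] t < w₀ + ℓ × 0 % m ≡ (c + t) % m → ∃[ t ] t < w₀ + ℓ × (ℓ + ℓ) % m ≡ (c + t) % m → ⊥
      apart (t₁ , t₁< , eq₁) (t₂ , t₂< , eq₂) = span-diameter 4ℓ≤m c
        (<-≤-trans t₁< w₀+ℓ≤ℓ+ℓ) (<-≤-trans t₂< w₀+ℓ≤ℓ+ℓ) (sym eq₁) (sym (trans (sym (m<n⇒m%n≡m 2ℓ<m)) eq₂))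

  ℓ+ℓ≤m⇐3ℓ≤1+m : ℓ + ℓ + ℓ ≤ suc m → ℓ + ℓ ≤ m
  ℓ+ℓ≤m⇐3ℓ≤1+m 3ℓ≤1+m = s≤s⁻¹ (≤-trans (subst (_≤ ℓ + ℓ + ℓ) (+-comm (ℓ + ℓ) 1) (+-monoʳ-≤ (ℓ + ℓ) z<s)) 3ℓ≤1+m)

  -- The windows c, …, c + w avoid i, so i lies past c + w and i + ℓ − 1 past the end c + w + ℓ − 1.
  arc-avoiding : ℓ + ℓ + ℓ ≤ suc m → ∀ c {w i t₁ t₂} → i < m → w ≤ ℓ → t₁ < w + ℓ → t₂ < w + ℓ →
                 (∀ {t} → t ≤ w → (c + t) % m ≢ i) → i ≡ (c + t₁) % m → (i + suc ℓ₀) % m ≢ (c + t₂) % m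
  arc-avoiding 3ℓ≤1+m c {w} {i} {t₁} {t₂} i<m w≤ℓ t₁< t₂< avoids i≡ i+ℓ-1≡ with %-offset c i<m
  ... | o , o<m , i≡c+o = <-irrefl refl (<-≤-trans t₂< (subst (w + ℓ ≤_) (sym t₂≡o+ℓ-1) w+ℓ≤o+ℓ-1))
    where
    ℓ+ℓ≤m : ℓ + ℓ ≤ m
    ℓ+ℓ≤m = ℓ+ℓ≤m⇐3ℓ≤1+m 3ℓ≤1+m
    t₁<ℓ+ℓ : t₁ < ℓ + ℓ
    t₁<ℓ+ℓ = <-≤-trans t₁< (+-monoˡ-≤ ℓ w≤ℓ)
    t₁≡o : t₁ ≡ o
    t₁≡o = +-cancelˡ-% c (<-≤-trans t₁<ℓ+ℓ ℓ+ℓ≤m) o<m (trans (sym i≡) i≡c+o)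
    w<o : w < o
    w<o with w <? o
    ... | yes w<o = w<o
    ... | no w≮o = ⊥-elim (avoids (≮⇒≥ w≮o) (sym i≡c+o))
    o+ℓ-1<m : o + suc ℓ₀ < m
    o+ℓ-1<m = s≤s⁻¹ (≤-trans (subst (_≤ ℓ + ℓ + ℓ) (cong suc (+-suc o (suc ℓ₀)))
                (+-monoˡ-≤ ℓ (subst (_< ℓ + ℓ) t₁≡o t₁<ℓ+ℓ))) 3ℓ≤1+m)
    t₂≡o+ℓ-1 : t₂ ≡ o + suc ℓ₀
    t₂≡o+ℓ-1 = +-cancelˡ-% c (<-≤-trans (<-≤-trans t₂< (+-monoˡ-≤ ℓ w≤ℓ)) ℓ+ℓ≤m) o+ℓ-1<m (begin
      (c + t₂) % m                  ≡⟨ i+ℓ-1≡ ⟨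
      (i + suc ℓ₀) % m              ≡⟨ cong (λ x → (x + suc ℓ₀) % m) i≡c+o ⟩
      ((c + o) % m + suc ℓ₀) % m    ≡⟨ [m%d+n]%d≡[m+n]%d (c + o) (suc ℓ₀) m ⟩
      (c + o + suc ℓ₀) % m          ≡⟨ cong (_% m) (+-assoc c o (suc ℓ₀)) ⟩
      (c + (o + suc ℓ₀)) % m        ∎)
      where open ≡-Reasoning
    w+ℓ≤o+ℓ-1 : w + ℓ ≤ o + suc ℓ₀
    w+ℓ≤o+ℓ-1 = s≤s⁻¹ (subst (suc (w + ℓ) ≤_) (+-suc o (suc ℓ₀)) (+-monoˡ-≤ ℓ w<o))

  deletion-disconnects : ℓ + ℓ + ℓ ≤ suc m → ∀ e → Edge (flower k n) e → ¬ ChainConnected k (deleteEdge (flower k n) e)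
  deletion-disconnects 3ℓ≤1+m e (i , i<m , e≡) connected =
    no-chain (connected (v i) (v (i + suc ℓ₀)) tt tt vi≢)
    where
    vi≢ : v i ≢ v (i + suc ℓ₀)
    vi≢ eq = 0≢1+n (v-cancel i (<-trans z<s ℓ<m) (<-trans (n<1+n (suc ℓ₀)) ℓ<m) (trans (cong v (+-identityʳ i)) eq))
    H : Hypergraph n
    H = deleteEdge (flower k n) e
    no-chain : ∃[ s ] IsChainIn k H s × v i ∈ₗ s × v (i + suc ℓ₀) ∈ₗ s → ⊥
    no-chain (s , (ws , _) , vi∈ , vi'∈) = apart (v∈⇒on-arc i vi∈) (v∈⇒on-arc (i + suc ℓ₀) vi'∈)
      where
      open WindowStructure H (λ _ → proj₁) (ℓ+ℓ≤m⇐3ℓ≤1+m 3ℓ≤1+m) ws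
      avoids : ∀ {t} → t ≤ w₀ → (c + t) % m ≢ i
      avoids t≤w₀ c+t≡i = proj₂ (arc-edge (s≤s t≤w₀)) (trans (cong petal c+t≡i) (sym e≡))
      apart : ∃[ t ] t < w₀ + ℓ × i % m ≡ (c + t) % m → ∃[ t ] t < w₀ + ℓ × (i + suc ℓ₀) % m ≡ (c + t) % m → ⊥
      apart (t₁ , t₁< , eq₁) (t₂ , t₂< , eq₂) = arc-avoiding 3ℓ≤1+m c i<m (s≤s⁻¹ W≤k) t₁< t₂< avoids
        (trans (sym (m<n⇒m%n≡m i<m)) eq₁) eq₂

  module WithoutLastPetal (ℓ+ℓ≤m : ℓ + ℓ ≤ m) (1+m<3ℓ : suc m < ℓ + ℓ + ℓ) where

    H : Hypergraph n
    H = deleteEdge (flower k n) (petal m₀)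

    last-start : ℕ
    last-start = m ∸ (ℓ + 2)

    last-start+ℓ+2≡m : last-start + (ℓ + 2) ≡ m
    last-start+ℓ+2≡m = m∸n+n≡m (≤-trans (+-monoʳ-≤ ℓ (s≤s (s≤s z≤n))) ℓ+ℓ≤m)

    last-start+ℓ<m₀ : last-start + ℓ < m₀
    last-start+ℓ<m₀ = ≤-reflexive (suc-injective (trans (sym (regroup last-start ℓ)) last-start+ℓ+2≡m))
      where
      regroup : ∀ x y → x + (y + 2) ≡ suc (suc (x + y))
      regroup = solve-∀

    Good : ℕ → Set
    Good c = c ≤ last-start

    good-arc-edge : ∀ {c} → Good c → ∀ {j} → j ≤ ℓ → Edge H (petal ((c + j) % m))
    good-arc-edge {c} c≤last {j} j≤ℓ = flower-arc-edge (c + j) , λ eq →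
      <-irrefl (trans (sym (m<n⇒m%n≡m (<-trans c+j<m₀ (n<1+n m₀)))) (petal-injective (m%n<n (c + j) m) (n<1+n m₀) eq)) c+j<m₀
      where
      c+j<m₀ : c + j < m₀
      c+j<m₀ = ≤-<-trans (+-mono-≤ c≤last j≤ℓ) last-start+ℓ<m₀

    near-end : ∀ {x} → x < m → x ∸ last-start < ℓ + ℓ
    near-end {x} x<m with last-start ≤? x
    ... | no x<last = subst (_< ℓ + ℓ) (sym (m≤n⇒m∸n≡0 (<⇒≤ (≰⇒> x<last)))) (<-trans z<s (m<m+n ℓ z<s))
    ... | yes last≤x = <-≤-trans (+-cancelˡ-< last-start (x ∸ last-start) (ℓ + 2)
        (subst₂ _<_ (sym (m+[n∸m]≡n last≤x)) (sym last-start+ℓ+2≡m) x<m)) (+-monoʳ-≤ ℓ (s≤s (s≤s z≤n)))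

    wrapped-near-start : ∀ {a b} → ℓ + ℓ ≤ b ∸ a → b < m → m ∸ last-start + a < ℓ + ℓ
    wrapped-near-start {a} {b} far b<m = subst (_< ℓ + ℓ) (sym (trans (cong (_+ a) m∸last≡ℓ+2) (+-assoc ℓ 2 a))) ℓ+[2+a]<ℓ+ℓ
      where
      m∸last≡ℓ+2 : m ∸ last-start ≡ ℓ + 2
      m∸last≡ℓ+2 = trans (cong (_∸ last-start) (sym last-start+ℓ+2≡m)) (m+n∸m≡n last-start (ℓ + 2))
      a+ℓ+ℓ<m : a + (ℓ + ℓ) < m
      a+ℓ+ℓ<m = ≤-<-trans (+-monoʳ-≤ a far) (subst (_< m) (sym (m+[n∸m]≡n (a≤b far))) b<m)
        where
        a≤b : ℓ + ℓ ≤ b ∸ a → a ≤ b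
        a≤b ℓ+ℓ≤b∸a with a ≤? b
        ... | yes a≤b = a≤b
        ... | no a≰b  = ⊥-elim (<⇒≱ (m<m+n 0 (<-≤-trans z<s (m≤m+n ℓ ℓ))) (subst (ℓ + ℓ ≤_) (m≤n⇒m∸n≡0 (<⇒≤ (≰⇒> a≰b))) ℓ+ℓ≤b∸a))
      a+3≤ℓ : a + 3 ≤ ℓ
      a+3≤ℓ = +-cancelʳ-≤ (ℓ + ℓ) (a + 3) ℓ (subst₂ _≤_ (regroup a (ℓ + ℓ)) (+-comm (ℓ + ℓ) ℓ) (≤-trans (s≤s (s≤s a+ℓ+ℓ<m)) 1+m<3ℓ))
        where
        regroup : ∀ x y → suc (suc (suc (x + y))) ≡ x + 3 + y
        regroup = solve-∀
      ℓ+[2+a]<ℓ+ℓ : ℓ + (2 + a) < ℓ + ℓ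
      ℓ+[2+a]<ℓ+ℓ = subst (_≤ ℓ + ℓ) (regroup ℓ a) (+-monoʳ-≤ ℓ a+3≤ℓ)
        where
        regroup : ∀ x y → x + (y + 3) ≡ suc (x + (2 + y))
        regroup = solve-∀

    spanned : ∀ {a b} → a ≤ b → b < m → ∃[ c ] Good c × OnSpan c a × OnSpan c b
    spanned {a} {b} a≤b b<m with close-or-wrapped m<4ℓ a≤b b<m | a ≤? last-start | b ≤? last-start
      where
      m<4ℓ : m < (ℓ + ℓ) + (ℓ + ℓ)
      m<4ℓ = <-≤-trans (<-trans (n<1+n m) 1+m<3ℓ) (+-monoʳ-≤ (ℓ + ℓ) (m≤m+n ℓ ℓ))
    ... | inj₁ close | yes a≤last | _ = a , a≤last , on-span-self a , on-span a b a≤b close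
    ... | inj₁ close | no a≰last  | _ = last-start , ≤-refl
        , on-span last-start a last≤a (near-end (≤-<-trans a≤b b<m)) , on-span last-start b (≤-trans last≤a a≤b) (near-end b<m)
      where
      last≤a : last-start ≤ a
      last≤a = <⇒≤ (≰⇒> a≰last)
    ... | inj₂ (_ , wrapped) | _ | yes b≤last = b , b≤last , on-span-wrapped b a (<⇒≤ b<m) wrapped , on-span-self b
    ... | inj₂ (far , _) | _ | no b≰last = last-start , ≤-refl
        , on-span-wrapped last-start a (m∸n≤m m (ℓ + 2)) (wrapped-near-start far b<m) , on-span last-start b (<⇒≤ (≰⇒> b≰last)) (near-end b<m)

    hypertree : IsHypertree k H
    hypertree = chain-connected-by-arcs ℓ+ℓ≤m H (λ _ → tt) Good good-arc-edge spanned
              , semicycle-free (λ _ → proj₁) ℓ+ℓ≤m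

  hypertree⇔ : IsHypertree k (flower k n) ⇔ (ℓ + ℓ ≤ m × m < (ℓ + ℓ) + (ℓ + ℓ))
  hypertree⇔ = mk⇔ necessary sufficient
    where
    necessary : IsHypertree k (flower k n) → ℓ + ℓ ≤ m × m < (ℓ + ℓ) + (ℓ + ℓ)
    necessary (connected , free) =
        decidable-stable (ℓ + ℓ ≤? m) (λ ℓ+ℓ≰m → flower-not-semicycle-free (≰⇒> ℓ+ℓ≰m) free)
      , decidable-stable (m <? _) (λ m≮4ℓ → flower-not-chain-connected (≮⇒≥ m≮4ℓ) connected)
    sufficient : ℓ + ℓ ≤ m × m < (ℓ + ℓ) + (ℓ + ℓ) → IsHypertree k (flower k n)
    sufficient (ℓ+ℓ≤m , m<4ℓ) = flower-chain-connected ℓ+ℓ≤m m<4ℓ , semicycle-free flower-petal-edges ℓ+ℓ≤m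

  edge-minimal⇔ : IsEdgeMinimalHypertree k (flower k n) ⇔ (ℓ + ℓ + ℓ ≤ suc m × m < (ℓ + ℓ) + (ℓ + ℓ))
  edge-minimal⇔ = mk⇔ necessary sufficient
    where
    necessary : IsEdgeMinimalHypertree k (flower k n) → ℓ + ℓ + ℓ ≤ suc m × m < (ℓ + ℓ) + (ℓ + ℓ)
    necessary (tree , minimal) = decidable-stable (_ ≤? suc m) last-petal-needed , proj₂ bounds
      where
      bounds : ℓ + ℓ ≤ m × m < (ℓ + ℓ) + (ℓ + ℓ)
      bounds = Equivalence.to hypertree⇔ tree
      last-petal-needed : ¬ ℓ + ℓ + ℓ ≰ suc m
      last-petal-needed 3ℓ≰1+m = minimal (petal m₀) (m₀ , n<1+n m₀ , refl) hypertree
        where open WithoutLastPetal (proj₁ bounds) (≰⇒> 3ℓ≰1+m)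
    sufficient : ℓ + ℓ + ℓ ≤ suc m × m < (ℓ + ℓ) + (ℓ + ℓ) → IsEdgeMinimalHypertree k (flower k n)
    sufficient (3ℓ≤1+m , m<4ℓ) = Equivalence.from hypertree⇔ (ℓ+ℓ≤m⇐3ℓ≤1+m 3ℓ≤1+m , m<4ℓ)
                               , λ e e∈ (connected , _) → deletion-disconnects 3ℓ≤1+m e e∈ connected

  2k∸1≤n⇔ : 2 * k ∸ 1 ≤ n ⇔ ℓ + ℓ ≤ m
  2k∸1≤n⇔ = mk⇔ (λ le → s≤s⁻¹ (subst (_≤ n) 2k∸1≡ le)) (λ le → subst (_≤ n) (sym 2k∸1≡) (s≤s le))
    where
    2k∸1≡ : 2 * k ∸ 1 ≡ suc (ℓ + ℓ)
    2k∸1≡ = trans (+-suc ℓ (ℓ + 0)) (cong (λ x → suc (ℓ + x)) (+-identityʳ ℓ))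

  n≤4[k∸1]⇔ : n ≤ 4 * (k ∸ 1) ⇔ m < (ℓ + ℓ) + (ℓ + ℓ)
  n≤4[k∸1]⇔ = mk⇔ (subst (n ≤_) (4x≡ ℓ)) (subst (n ≤_) (sym (4x≡ ℓ)))
    where
    4x≡ : ∀ x → 4 * x ≡ (x + x) + (x + x)
    4x≡ = solve-∀

  3[k∸1]≤n⇔ : 3 * (k ∸ 1) ≤ n ⇔ ℓ + ℓ + ℓ ≤ suc m
  3[k∸1]≤n⇔ = mk⇔ (subst (_≤ n) (3x≡ ℓ)) (subst (_≤ n) (sym (3x≡ ℓ)))
    where
    3x≡ : ∀ x → 3 * x ≡ x + x + x
    3x≡ = solve-∀

mainTheorem7 : ∀ (k n : ℕ) → 2 < k → k < n →
    (IsHypertree k (flower k n) ⇔ ((2 * k ∸ 1 ≤ n) × (n ≤ 4 * (k ∸ 1))))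
    × (IsEdgeMinimalHypertree k (flower k n) ⇔ ((3 * (k ∸ 1) ≤ n) × (n ≤ 4 * (k ∸ 1))))
mainTheorem7 (suc (suc (suc ℓ₀))) (suc (suc m₀)) (s≤s (s≤s (s≤s _))) (s≤s ℓ<m) =
    ⇔.trans hypertree⇔ (⇔.sym (2k∸1≤n⇔ ×-⇔ n≤4[k∸1]⇔))
  , ⇔.trans edge-minimal⇔ (⇔.sym (3[k∸1]≤n⇔ ×-⇔ n≤4[k∸1]⇔))
  where open Flower ℓ₀ m₀ ℓ<m
mainTheorem7 (suc (suc (suc _))) zero       _ ()
mainTheorem7 (suc (suc (suc _))) (suc zero) _ (s≤s ())
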